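{- Let $G$ be a finite simple graph with an odd number of vertices and at least one edge. Then $$\mathrm{mp}(G)\leq \xi(G)+1.$$ Moreover, the bound is sharp, i.e., there exist graphs with an odd number of vertices for which equality holds.
   Context: All graphs are finite, simple and undirected. A perfect matching of $G$ is a set of edges such that every vertex is incident with exactly one of them; an almost-perfect matching is a set of edges such that every vertex except one is incident with exactly one of them and the exceptional vertex is incident with none. The matching preclusion number $\mathrm{mp}(G)$ is the minimum number of edges whose deletion leaves a graph with neither a perfect matching nor an almost-perfect matching; $\mathrm{mp}(G)=0$ if $G$ itself has neither. For an edge $uv$, $\xi_G(uv)=d_G(u)+d_G(v)-2$, and $\xi(G)=\min\{\xi_G(uv): uv\in E(G)\}$ is the minimum edge-degree of $G$. -}

module Defs where

open import Data.Nat using (ℕ; zero; suc; _+_; _∸_; _≤_)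
open import Data.Bool using (Bool; true; false; _∧_; not; if_then_else_)
open import Data.Fin using (Fin; toℕ)
open import Data.List using (List; map; allFin)
open import Data.Nat.ListAction using (sum)
open import Data.Nat using (_<ᵇ_)
open import Data.Product using (Σ; _×_; ∃; ∃-syntax)
open import Relation.Binary.PropositionalEquality using (_≡_; _≢_)
open import Relation.Nullary using (¬_)

record Graph (n : ℕ) : Set where
  field
    adj    : Fin n → Fin n → Bool
    sym    : ∀ i j → adj i j ≡ adj j i
    irrefl : ∀ i → adj i i ≡ false
open Graph public

countRow : {n : ℕ} → (Fin n → Fin n → Bool) → Fin n → ℕ
countRow {n} R i = sum (map (λ j → if R i j then 1 else 0) (allFin n))

countPairs : {n : ℕ} → (Fin n → Fin n → Bool) → ℕ
countPairs {n} R =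
  sum (map (λ i → sum (map (λ j → if (toℕ i <ᵇ toℕ j) ∧ R i j then 1 else 0) (allFin n))) (allFin n))

degree : {n : ℕ} → Graph n → Fin n → ℕ
degree G v = countRow (adj G) v

HasEdge : {n : ℕ} → Graph n → Set
HasEdge {n} G = ∃[ u ] ∃[ v ] (adj G u v ≡ true)

edgeDegree : {n : ℕ} → Graph n → Fin n → Fin n → ℕ
edgeDegree G u v = degree G u + degree G v ∸ 2

IsMinEdgeDegree : {n : ℕ} → Graph n → ℕ → Set
IsMinEdgeDegree {n} G m =
  (Σ (Fin n) λ u → Σ (Fin n) λ v → (adj G u v ≡ true) × (edgeDegree G u v ≡ m))
  × (∀ u v → adj G u v ≡ true → m ≤ edgeDegree G u v)

record EdgeSet {n : ℕ} (G : Graph n) : Set where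
  field
    mem    : Fin n → Fin n → Bool
    memSym : ∀ i j → mem i j ≡ mem j i
    memSub : ∀ i j → mem i j ≡ true → adj G i j ≡ true
open EdgeSet public

ExactlyOne : {n : ℕ} {G : Graph n} → EdgeSet G → Fin n → Set
ExactlyOne {n} M i = Σ (Fin n) λ j → (mem M i j ≡ true) × (∀ k → mem M i k ≡ true → k ≡ j)

IsPerfectMatching : {n : ℕ} {G : Graph n} → EdgeSet G → Set
IsPerfectMatching M = ∀ i → ExactlyOne M i

IsAlmostPerfectMatching : {n : ℕ} {G : Graph n} → EdgeSet G → Set
IsAlmostPerfectMatching {n} M =
  Σ (Fin n) λ v → (∀ k → mem M v k ≡ false) × (∀ i → i ≢ v → ExactlyOne M i)

HasPerfectMatching : {n : ℕ} → Graph n → Set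
HasPerfectMatching G = Σ (EdgeSet G) IsPerfectMatching

HasAlmostPerfectMatching : {n : ℕ} → Graph n → Set
HasAlmostPerfectMatching G = Σ (EdgeSet G) IsAlmostPerfectMatching

deleteEdges : {n : ℕ} (G : Graph n) → EdgeSet G → Graph n
deleteEdges G F = record
  { adj    = λ i j → adj G i j ∧ not (mem F i j)
  ; sym    = λ i j → helper i j
  ; irrefl = λ i → irr i
  }
  where
    open import Relation.Binary.PropositionalEquality using (cong₂; cong)
    helper : ∀ i j → (adj G i j ∧ not (mem F i j)) ≡ (adj G j i ∧ not (mem F j i))
    helper i j = cong₂ _∧_ (sym G i j) (cong not (memSym F i j))
    irr : ∀ i → (adj G i i ∧ not (mem F i i)) ≡ false
    irr i rewrite irrefl G i = Relation.Binary.PropositionalEquality.refl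

size : {n : ℕ} {G : Graph n} → EdgeSet G → ℕ
size F = countPairs (mem F)

-- mp(G) ≤ k : there is a set of at most k edges whose deletion leaves a graph
-- with neither a perfect nor an almost-perfect matching (k = 0 / empty F covers
-- the case where G itself has neither).
MpAtMost : {n : ℕ} → Graph n → ℕ → Set
MpAtMost G k = Σ (EdgeSet G) λ F → (size F ≤ k)
  × ¬ HasPerfectMatching (deleteEdges G F)
  × ¬ HasAlmostPerfectMatching (deleteEdges G F)

MpEquals : {n : ℕ} → Graph n → ℕ → Set
MpEquals G k = MpAtMost G k × (∀ j → MpAtMost G j → k ≤ j)

Odd : ℕ → Set
Odd n = ∃[ k ] (n ≡ suc (k + k))

module Submission where

-- Let uv be an edge with ξ(uv) = ξ(G), and let F be the set of
-- all edges incident with u or v.  In G - F both u and v are isolated, so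
-- G - F has no perfect matching (u is unmatched) and no almost-perfect
-- matching (at most one vertex may be unmatched).  Splitting F into the star
-- of u in G and the star of v in G - u shows |F| ≤ d(u) + (d(v) - 1), since
-- the edge uv is counted only once; this is ξ(uv) + 1.
--
-- Sharpness.  K₂ + K₁ (one edge and an isolated vertex) has ξ = 0, and its
-- single edge is an almost-perfect matching, so at least one edge must be
-- deleted: mp = 1 = ξ + 1.

open import Defs hiding (sym)
open import Data.Nat using (ℕ; zero; suc; _+_; _*_; _∸_; _≤_; z≤n; s≤s; _<ᵇ_; _≡ᵇ_)
open import Data.Nat.Properties
  using (+-*-semiring; ≤-refl; ≤-trans; ≤-reflexive; +-mono-≤; +-monoʳ-≤; m≤m+n;
         +-suc; +-comm; *-comm; *-zeroʳ; *-identityˡ; *-identityʳ; +-identityʳ; 1+n≰n; module ≤-Reasoning)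
open import Data.Bool using (Bool; true; false; _∧_; _∨_; not; if_then_else_)
open import Data.Bool.Properties using (∨-comm; ∨-zeroʳ; ∧-assoc)
open import Data.Fin using (Fin; zero; suc; toℕ; punchIn)
open import Data.Fin.Properties using (_≟_; punchInᵢ≢i)
open import Data.List using (map; tabulate)
open import Data.Nat.ListAction using (sum)
open import Data.Product using (Σ; _×_; _,_)
open import Data.Empty using (⊥; ⊥-elim)
open import Function using (_∘_; id)
open import Relation.Nullary using (¬_; yes; no; does)
open import Relation.Nullary.Decidable using (dec-true; dec-false)
open import Relation.Binary.PropositionalEquality
  using (_≡_; _≢_; refl; sym; trans; cong; cong₂; subst; module ≡-Reasoning)
open import Algebra.Properties.Semiring.Sum +-*-semiring
  using (sum-cong-≗; sum-remove; ∑-distrib-+; *-distribˡ-sum)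
  renaming (sum to ∑)

𝟙 : Bool → ℕ
𝟙 b = if b then 1 else 0

_==_ : ∀ {n} → Fin n → Fin n → Bool
i == j = does (i ≟ j)

==-refl : ∀ {n} (i : Fin n) → (i == i) ≡ true
==-refl i = dec-true (i ≟ i) refl

==-≢ : ∀ {n} {i j : Fin n} → i ≢ j → (i == j) ≡ false
==-≢ {i = i} {j} = dec-false (i ≟ j)

_≺_ : ∀ {n} → Fin n → Fin n → Bool
i ≺ j = toℕ i <ᵇ toℕ j

sum-map-tabulate : ∀ {m n} (f : Fin m → ℕ) (g : Fin n → Fin m) →
                   sum (map f (tabulate g)) ≡ ∑ (f ∘ g)
sum-map-tabulate {n = zero}  f g = refl
sum-map-tabulate {n = suc n} f g = cong (f (g zero) +_) (sum-map-tabulate f (g ∘ suc))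

∑-mono-≤ : ∀ {n} {f g : Fin n → ℕ} → (∀ i → f i ≤ g i) → ∑ f ≤ ∑ g
∑-mono-≤ {zero}  f≤g = z≤n
∑-mono-≤ {suc n} f≤g = +-mono-≤ (f≤g zero) (∑-mono-≤ (f≤g ∘ suc))

∑-zero : ∀ {n} {f : Fin n → ℕ} → (∀ i → f i ≡ 0) → ∑ f ≡ 0
∑-zero {zero}  f≡0 = refl
∑-zero {suc n} f≡0 = cong₂ _+_ (f≡0 zero) (∑-zero (f≡0 ∘ suc))

term≤∑ : ∀ {n} (f : Fin n → ℕ) (i : Fin n) → f i ≤ ∑ f
term≤∑ {suc n} f i = ≤-trans (m≤m+n (f i) _) (≤-reflexive (sym (sum-remove {i = i} f)))

∑-point : ∀ {n} (f : Fin n → ℕ) (w : Fin n) → ∑ (λ j → f j * 𝟙 (j == w)) ≡ f w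
∑-point {suc n} f w = begin
    ∑ (λ j → f j * 𝟙 (j == w))
  ≡⟨ sum-remove {i = w} (λ j → f j * 𝟙 (j == w)) ⟩
    f w * 𝟙 (w == w) + ∑ (λ k → f (punchIn w k) * 𝟙 (punchIn w k == w))
  ≡⟨ cong₂ _+_ (cong (λ b → f w * 𝟙 b) (==-refl w)) (∑-zero off-w) ⟩
    f w * 1 + 0
  ≡⟨ trans (+-identityʳ _) (*-identityʳ (f w)) ⟩
    f w ∎
  where
    open ≡-Reasoning
    off-w : ∀ k → f (punchIn w k) * 𝟙 (punchIn w k == w) ≡ 0
    off-w k = trans (cong (λ b → f (punchIn w k) * 𝟙 b) (==-≢ (punchInᵢ≢i w k)))
                    (*-zeroʳ (f (punchIn w k)))

∑-δ : ∀ {n} (w : Fin n) → ∑ (λ j → 𝟙 (j == w)) ≡ 1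
∑-δ w = trans (sum-cong-≗ (λ j → sym (*-identityˡ (𝟙 (j == w))))) (∑-point (λ _ → 1) w)

∑∑-row : ∀ {n} (f : Fin n → Fin n → ℕ) (w : Fin n) →
         ∑ (λ i → ∑ (λ j → 𝟙 (i == w) * f i j)) ≡ ∑ (f w)
∑∑-row f w = begin
    ∑ (λ i → ∑ (λ j → 𝟙 (i == w) * f i j))
  ≡⟨ sum-cong-≗ (λ i → sym (*-distribˡ-sum (𝟙 (i == w)) (f i))) ⟩
    ∑ (λ i → 𝟙 (i == w) * ∑ (f i))
  ≡⟨ sum-cong-≗ (λ i → *-comm (𝟙 (i == w)) (∑ (f i))) ⟩
    ∑ (λ i → ∑ (f i) * 𝟙 (i == w))
  ≡⟨ ∑-point (λ i → ∑ (f i)) w ⟩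
    ∑ (f w) ∎
  where
    open ≡-Reasoning

∑∑-col : ∀ {n} (f : Fin n → Fin n → ℕ) (w : Fin n) →
         ∑ (λ i → ∑ (λ j → f i j * 𝟙 (j == w))) ≡ ∑ (λ i → f i w)
∑∑-col f w = sum-cong-≗ (λ i → ∑-point (f i) w)

∑∑-distrib-+ : ∀ {n} (f g : Fin n → Fin n → ℕ) →
               ∑ (λ i → ∑ (λ j → f i j + g i j)) ≡ ∑ (λ i → ∑ (f i)) + ∑ (λ i → ∑ (g i))
∑∑-distrib-+ f g = trans (sum-cong-≗ (λ i → ∑-distrib-+ (f i) (g i))) (∑-distrib-+ (λ i → ∑ (f i)) (λ i → ∑ (g i)))

countRow≡∑ : ∀ {n} (R : Fin n → Fin n → Bool) (i : Fin n) →
             countRow R i ≡ ∑ (λ j → 𝟙 (R i j))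
countRow≡∑ R i = sum-map-tabulate (λ j → 𝟙 (R i j)) id

countPairs≡∑∑ : ∀ {n} (R : Fin n → Fin n → Bool) →
                countPairs R ≡ ∑ (λ i → ∑ (λ j → 𝟙 (i ≺ j ∧ R i j)))
countPairs≡∑∑ R = trans (sum-map-tabulate (λ i → countRow (λ i j → i ≺ j ∧ R i j) i) id)
                        (sum-cong-≗ (λ i → sum-map-tabulate (λ j → 𝟙 (i ≺ j ∧ R i j)) id))

𝟙-∧-cover : ∀ l {r s t} → (r ≡ true → (s ∨ t) ≡ true) → 𝟙 (l ∧ r) ≤ 𝟙 (l ∧ s) + 𝟙 (l ∧ t)
𝟙-∧-cover false               _ = z≤n
𝟙-∧-cover true {false}        _ = z≤n
𝟙-∧-cover true {true} {true}  _ = s≤s z≤n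
𝟙-∧-cover true {true} {false} {true}  _ = s≤s z≤n
𝟙-∧-cover true {true} {false} {false} r⇒s∨t with r⇒s∨t refl
... | ()

countPairs-cover : ∀ {n} (R S T : Fin n → Fin n → Bool) →
                   (∀ i j → R i j ≡ true → (S i j ∨ T i j) ≡ true) →
                   countPairs R ≤ countPairs S + countPairs T
countPairs-cover R S T cover = begin
    countPairs R
  ≡⟨ countPairs≡∑∑ R ⟩
    ∑ (λ i → ∑ (λ j → 𝟙 (i ≺ j ∧ R i j)))
  ≤⟨ ∑-mono-≤ (λ i → ∑-mono-≤ (λ j → 𝟙-∧-cover (i ≺ j) (cover i j))) ⟩
    ∑ (λ i → ∑ (λ j → 𝟙 (i ≺ j ∧ S i j) + 𝟙 (i ≺ j ∧ T i j)))
  ≡⟨ ∑∑-distrib-+ (λ i j → 𝟙 (i ≺ j ∧ S i j)) (λ i j → 𝟙 (i ≺ j ∧ T i j)) ⟩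
    ∑ (λ i → ∑ (λ j → 𝟙 (i ≺ j ∧ S i j))) + ∑ (λ i → ∑ (λ j → 𝟙 (i ≺ j ∧ T i j)))
  ≡⟨ sym (cong₂ _+_ (countPairs≡∑∑ S) (countPairs≡∑∑ T)) ⟩
    countPairs S + countPairs T ∎
  where open ≤-Reasoning

countPairs-pos : ∀ {n} (R : Fin n → Fin n → Bool) {i j : Fin n} →
                 (i ≺ j) ≡ true → R i j ≡ true → 1 ≤ countPairs R
countPairs-pos R {i} {j} i≺j Rij = begin
    1
  ≡⟨ sym (cong₂ (λ x y → 𝟙 (x ∧ y)) i≺j Rij) ⟩
    𝟙 (i ≺ j ∧ R i j)
  ≤⟨ term≤∑ (λ k → 𝟙 (i ≺ k ∧ R i k)) j ⟩
    ∑ (λ k → 𝟙 (i ≺ k ∧ R i k))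
  ≤⟨ term≤∑ (λ l → ∑ (λ k → 𝟙 (l ≺ k ∧ R l k))) i ⟩
    ∑ (λ l → ∑ (λ k → 𝟙 (l ≺ k ∧ R l k)))
  ≡⟨ sym (countPairs≡∑∑ R) ⟩
    countPairs R ∎
  where open ≤-Reasoning

incident : ∀ {n} → (Fin n → Fin n → Bool) → (Fin n → Bool) → Fin n → Fin n → Bool
incident R c i j = R i j ∧ (c i ∨ c j)

-- A pair with an endpoint in c is charged to that endpoint: to the first
-- one if it lies in c (x), otherwise to the second (y).
𝟙-incident : ∀ a x y → 𝟙 (a ∧ (x ∨ y)) ≤ 𝟙 x * 𝟙 a + 𝟙 a * 𝟙 y
𝟙-incident false x     y     = z≤n
𝟙-incident true  true  y     = s≤s z≤n
𝟙-incident true  false true  = s≤s z≤n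
𝟙-incident true  false false = z≤n

𝟙-==-subst : ∀ {n} (f : Fin n → ℕ) (i w : Fin n) → 𝟙 (i == w) * f i ≡ 𝟙 (i == w) * f w
𝟙-==-subst f i w with i ≟ w
... | yes refl = refl
... | no  _    = refl

<ᵇ-exclusive : ∀ x y → 𝟙 (x <ᵇ y) + 𝟙 (y <ᵇ x) ≤ 1
<ᵇ-exclusive zero    zero    = z≤n
<ᵇ-exclusive zero    (suc y) = s≤s z≤n
<ᵇ-exclusive (suc x) zero    = s≤s z≤n
<ᵇ-exclusive (suc x) (suc y) = <ᵇ-exclusive x y

-- Hence a pair {w,j} is counted at most once among "w before j" and
-- "j before w".
𝟙-∧-exclusive : ∀ x y c → 𝟙 x + 𝟙 y ≤ 1 → 𝟙 (x ∧ c) + 𝟙 (y ∧ c) ≤ 𝟙 c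
𝟙-∧-exclusive true  true  c     (s≤s ())
𝟙-∧-exclusive true  false true  _ = s≤s z≤n
𝟙-∧-exclusive true  false false _ = z≤n
𝟙-∧-exclusive false true  true  _ = s≤s z≤n
𝟙-∧-exclusive false true  false _ = z≤n
𝟙-∧-exclusive false false c     _ = z≤n

countPairs-star : ∀ {n} (H : Graph n) (w : Fin n) →
                  countPairs (incident (adj H) (_== w)) ≤ degree H w
countPairs-star {n} H w = begin
    countPairs (incident (adj H) (_== w))
  ≡⟨ countPairs≡∑∑ (incident (adj H) (_== w)) ⟩
    ∑ (λ i → ∑ (λ j → 𝟙 (i ≺ j ∧ (adj H i j ∧ ((i == w) ∨ (j == w))))))
  ≤⟨ ∑-mono-≤ (λ i → ∑-mono-≤ (λ j → charge i j)) ⟩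
    ∑ (λ i → ∑ (λ j → 𝟙 (i == w) * e w j + e i w * 𝟙 (j == w)))
  ≡⟨ ∑∑-distrib-+ (λ i j → 𝟙 (i == w) * e w j) (λ i j → e i w * 𝟙 (j == w)) ⟩
    ∑ (λ i → ∑ (λ j → 𝟙 (i == w) * e w j)) + ∑ (λ i → ∑ (λ j → e i w * 𝟙 (j == w)))
  ≡⟨ cong₂ _+_ (∑∑-row (λ _ → e w) w) (∑∑-col (λ i _ → e i w) w) ⟩
    ∑ (e w) + ∑ (λ j → e j w)
  ≡⟨ sym (∑-distrib-+ (e w) (λ j → e j w)) ⟩
    ∑ (λ j → e w j + e j w)
  ≤⟨ ∑-mono-≤ counted-once ⟩
    ∑ (λ j → 𝟙 (adj H w j))
  ≡⟨ sym (countRow≡∑ (adj H) w) ⟩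
    degree H w ∎
  where
    open ≤-Reasoning
    e : Fin n → Fin n → ℕ
    e i j = 𝟙 (i ≺ j ∧ adj H i j)

    charge : ∀ i j → 𝟙 (i ≺ j ∧ (adj H i j ∧ ((i == w) ∨ (j == w))))
                     ≤ 𝟙 (i == w) * e w j + e i w * 𝟙 (j == w)
    charge i j = begin
        𝟙 (i ≺ j ∧ (adj H i j ∧ ((i == w) ∨ (j == w))))
      ≡⟨ cong 𝟙 (sym (∧-assoc (i ≺ j) (adj H i j) _)) ⟩
        𝟙 ((i ≺ j ∧ adj H i j) ∧ ((i == w) ∨ (j == w)))
      ≤⟨ 𝟙-incident (i ≺ j ∧ adj H i j) (i == w) (j == w) ⟩
        𝟙 (i == w) * e i j + e i j * 𝟙 (j == w)
      ≡⟨ cong₂ _+_ (𝟙-==-subst (λ k → e k j) i w)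
                   (trans (*-comm (e i j) _) (trans (𝟙-==-subst (e i) j w) (*-comm _ (e i w)))) ⟩
        𝟙 (i == w) * e w j + e i w * 𝟙 (j == w) ∎

    counted-once : ∀ j → e w j + e j w ≤ 𝟙 (adj H w j)
    counted-once j rewrite Graph.sym H j w =
      𝟙-∧-exclusive (w ≺ j) (j ≺ w) (adj H w j) (<ᵇ-exclusive (toℕ w) (toℕ j))

incidentEdges : ∀ {n} (G : Graph n) → (Fin n → Bool) → EdgeSet G
incidentEdges G c = record
  { mem    = incident (adj G) c
  ; memSym = λ i j → cong₂ _∧_ (Graph.sym G i j) (∨-comm (c i) (c j))
  ; memSub = λ i j → ∧-true-left
  }
  where
    ∧-true-left : ∀ {x y} → (x ∧ y) ≡ true → x ≡ true
    ∧-true-left {true} _ = refl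

isolate : ∀ {n} → Graph n → (Fin n → Bool) → Graph n
isolate G c = deleteEdges G (incidentEdges G c)

Isolated : ∀ {n} → Graph n → Fin n → Set
Isolated H w = ∀ j → adj H w j ≡ false

isolate-isolates : ∀ {n} (G : Graph n) (c : Fin n → Bool) {w : Fin n} →
                   c w ≡ true → Isolated (isolate G c) w
isolate-isolates G c {w} cw j rewrite cw with adj G w j
... | true  = refl
... | false = refl

degree-isolate-neighbour : ∀ {n} (G : Graph n) {u v : Fin n} →
                           adj G v u ≡ true → v ≢ u →
                           suc (degree (isolate G (_== u)) v) ≤ degree G v
degree-isolate-neighbour {n} G {u} {v} vu v≢u = begin
    suc (degree G′ v)
  ≡⟨ cong₂ _+_ (sym (∑-δ u)) (countRow≡∑ (adj G′) v) ⟩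
    ∑ (λ j → 𝟙 (j == u)) + ∑ (λ j → 𝟙 (adj G′ v j))
  ≡⟨ sym (∑-distrib-+ (λ j → 𝟙 (j == u)) (λ j → 𝟙 (adj G′ v j))) ⟩
    ∑ (λ j → 𝟙 (j == u) + 𝟙 (adj G′ v j))
  ≤⟨ ∑-mono-≤ pointwise ⟩
    ∑ (λ j → 𝟙 (adj G v j))
  ≡⟨ sym (countRow≡∑ (adj G) v) ⟩
    degree G v ∎
  where
    open ≤-Reasoning
    G′ : Graph n
    G′ = isolate G (_== u)
    pointwise : ∀ j → 𝟙 (j == u) + 𝟙 (adj G′ v j) ≤ 𝟙 (adj G v j)
    pointwise j with j ≟ u
    ... | yes refl rewrite vu | ==-≢ v≢u = ≤-refl
    ... | no  _    rewrite ==-≢ v≢u with adj G v j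
    ...   | true  = ≤-refl
    ...   | false = z≤n

edges-survive : ∀ {n} {G : Graph n} (M F : EdgeSet G) →
                (∀ i j → mem M i j ≡ true → mem F i j ≡ false) →
                EdgeSet (deleteEdges G F)
edges-survive {G = G} M F disjoint = record
  { mem    = mem M
  ; memSym = memSym M
  ; memSub = λ i j ij∈M → cong₂ (λ a f → a ∧ not f) (memSub M i j ij∈M) (disjoint i j ij∈M)
  }

isolated-unmatched : ∀ {n} {H : Graph n} {w : Fin n} → Isolated H w →
                     (M : EdgeSet H) → ¬ ExactlyOne M w
isolated-unmatched {w = w} iso M (j , wj∈M , _) with trans (sym (memSub M w j wj∈M)) (iso j)
... | ()

isolated⇒¬perfect : ∀ {n} {H : Graph n} {w : Fin n} → Isolated H w → ¬ HasPerfectMatching H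
isolated⇒¬perfect iso (M , perfect) = isolated-unmatched iso M (perfect _)

-- An almost-perfect matching leaves only one vertex uncovered.
isolated²⇒¬almostPerfect : ∀ {n} {H : Graph n} {u v : Fin n} → u ≢ v →
                           Isolated H u → Isolated H v → ¬ HasAlmostPerfectMatching H
isolated²⇒¬almostPerfect {u = u} {v} u≢v isoU isoV (M , x , _ , covers) with x ≟ u
... | yes refl = isolated-unmatched isoV M (covers v (u≢v ∘ sym))
... | no  x≢u  = isolated-unmatched isoU M (covers u (x≢u ∘ sym))

incident-∪ : ∀ {n} (G : Graph n) (c d : Fin n → Bool) (i j : Fin n) →
             incident (adj G) (λ x → c x ∨ d x) i j ≡ true →
             (incident (adj G) c i j ∨ incident (adj (isolate G c)) d i j) ≡ true
incident-∪ G c d i j with adj G i j | c i | c j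
... | true | true  | _     = λ _ → refl
... | true | false | true  = λ _ → refl
... | true | false | false = id

-- Arithmetic form of |F| ≤ d(u) + (d(v) - 1) ≤ ξ(uv) + 1.
≤-suc-∸2 : ∀ {k m} → suc k ≤ m → k ≤ suc (m ∸ 2)
≤-suc-∸2 {m = suc zero}    (s≤s k≤0) = ≤-trans k≤0 z≤n
≤-suc-∸2 {m = suc (suc m)} (s≤s k≤m) = k≤m

mp≤edgeDegree+1 : ∀ {n} (G : Graph n) (u v : Fin n) → adj G u v ≡ true →
                  MpAtMost G (suc (edgeDegree G u v))
mp≤edgeDegree+1 {n} G u v uv =
  F , size-bound , isolated⇒¬perfect isoU , isolated²⇒¬almostPerfect u≢v isoU isoV
  where
    atUV : Fin n → Bool
    atUV x = (x == u) ∨ (x == v)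
    F : EdgeSet G
    F = incidentEdges G atUV

    u≢v : u ≢ v
    u≢v refl with trans (sym uv) (irrefl G u)
    ... | ()

    isoU : Isolated (isolate G atUV) u
    isoU = isolate-isolates G atUV (cong (_∨ (u == v)) (==-refl u))
    isoV : Isolated (isolate G atUV) v
    isoV = isolate-isolates G atUV (trans (cong ((v == u) ∨_) (==-refl v)) (∨-zeroʳ (v == u)))

    dᵤ dᵥ′ : ℕ
    dᵤ  = degree G u
    dᵥ′ = degree (isolate G (_== u)) v

    size≤ : size F ≤ dᵤ + dᵥ′
    size≤ = ≤-trans
      (countPairs-cover _ _ _ (incident-∪ G (_== u) (_== v)))
      (+-mono-≤ (countPairs-star G u) (countPairs-star (isolate G (_== u)) v))

    size-bound : size F ≤ suc (edgeDegree G u v)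
    size-bound = ≤-suc-∸2 (begin
        suc (size F)          ≤⟨ s≤s size≤ ⟩
        suc (dᵤ + dᵥ′)        ≡⟨ sym (+-suc dᵤ dᵥ′) ⟩
        dᵤ + suc dᵥ′          ≤⟨ +-monoʳ-≤ dᵤ (degree-isolate-neighbour G (trans (Graph.sym G v u) uv) (u≢v ∘ sym)) ⟩
        dᵤ + degree G v       ∎)
      where open ≤-Reasoning

-- Vertices 0 and 1 are adjacent; vertex 2 is isolated.
K₂+K₁ : Graph 3
K₂+K₁ = record
  { adj    = λ i j → (toℕ i + toℕ j) ≡ᵇ 1
  ; sym    = λ i j → cong (_≡ᵇ 1) (+-comm (toℕ i) (toℕ j))
  ; irrefl = λ { zero → refl ; (suc zero) → refl ; (suc (suc zero)) → refl }
  }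

K₂+K₁-ξ : IsMinEdgeDegree K₂+K₁ 0
K₂+K₁-ξ = (zero , suc zero , refl , refl) , λ _ _ _ → z≤n

K₂+K₁-edges : EdgeSet K₂+K₁
K₂+K₁-edges = record { mem = adj K₂+K₁ ; memSym = Graph.sym K₂+K₁ ; memSub = λ _ _ → id }

K₂+K₁-almostPerfect : IsAlmostPerfectMatching K₂+K₁-edges
K₂+K₁-almostPerfect = suc (suc zero) , (λ _ → refl) , covered
  where
    covered : ∀ i → i ≢ suc (suc zero) → ExactlyOne K₂+K₁-edges i
    covered zero             _   = suc zero , refl , λ { (suc zero) _ → refl ; zero () ; (suc (suc zero)) () }
    covered (suc zero)       _   = zero , refl , λ { zero _ → refl ; (suc zero) () ; (suc (suc zero)) () }
    covered (suc (suc zero)) i≢2 = ⊥-elim (i≢2 refl)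

K₂+K₁-survives : (F : EdgeSet K₂+K₁) → mem F zero (suc zero) ≡ false →
                 HasAlmostPerfectMatching (deleteEdges K₂+K₁ F)
K₂+K₁-survives F 01∉F = edges-survive K₂+K₁-edges F avoids , K₂+K₁-almostPerfect
  where
    avoids : ∀ i j → adj K₂+K₁ i j ≡ true → mem F i j ≡ false
    avoids zero             (suc zero)       _ = 01∉F
    avoids (suc zero)       zero             _ = trans (memSym F (suc zero) zero) 01∉F
    avoids zero             zero             ()
    avoids zero             (suc (suc zero)) ()
    avoids (suc zero)       (suc zero)       ()
    avoids (suc zero)       (suc (suc zero)) ()
    avoids (suc (suc zero)) _                ()

-- mp(K₂+K₁) ≥ 1: deleting no edge keeps the edge 01.
K₂+K₁-mp≥1 : ∀ k → MpAtMost K₂+K₁ k → 1 ≤ k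
K₂+K₁-mp≥1 (suc k) _ = s≤s z≤n
K₂+K₁-mp≥1 zero (F , size≤0 , _ , ¬almostPerfect) = ⊥-elim (by-edge-01 _ refl)
  where
    by-edge-01 : ∀ b → mem F zero (suc zero) ≡ b → ⊥
    by-edge-01 true  01∈F = 1+n≰n (≤-trans (countPairs-pos (mem F) refl 01∈F) size≤0)
    by-edge-01 false 01∉F = ¬almostPerfect (K₂+K₁-survives F 01∉F)

proposition2p3 :
    ((n : ℕ) → (G : Graph n) → Odd n → HasEdge G →
       (m : ℕ) → IsMinEdgeDegree G m → MpAtMost G (suc m))
    × (Σ ℕ λ n → Σ (Graph n) λ G → Odd n × HasEdge G ×
         (Σ ℕ λ m → IsMinEdgeDegree G m × MpEquals G (suc m)))
proposition2p3 = upper-bound , sharp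
  where
    upper-bound : (n : ℕ) → (G : Graph n) → Odd n → HasEdge G →
                  (m : ℕ) → IsMinEdgeDegree G m → MpAtMost G (suc m)
    upper-bound n G _ _ m ((u , v , uv , ξuv≡m) , _) =
      subst (λ k → MpAtMost G (suc k)) ξuv≡m (mp≤edgeDegree+1 G u v uv)

    sharp : Σ ℕ λ n → Σ (Graph n) λ G → Odd n × HasEdge G ×
              (Σ ℕ λ m → IsMinEdgeDegree G m × MpEquals G (suc m))
    sharp = 3 , K₂+K₁ , (1 , refl) , (zero , suc zero , refl) ,
            (0 , K₂+K₁-ξ , (mp≤edgeDegree+1 K₂+K₁ zero (suc zero) refl , K₂+K₁-mp≥1))
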